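{- Let $G$ be a graph having two vertices $u$ and $v$ with $\deg(u)=1$, $\deg(v)=2$ and $d(u,v)=2$, and let $H$ be a graph with at least one pendant vertex. Then the direct product $G\times H$ is not group vertex magic.
   Context: Graphs are finite, simple and undirected; $d(u,v)$ is the distance. For an additive Abelian group $\Gamma$ with identity $0$ and a graph $G$, a $\Gamma$-vertex magic labeling is a map $\ell:V(G)\to\Gamma\setminus\{0\}$ for which there is $\mu\in\Gamma$ with $w(v)=\sum_{u\in N(v)}\ell(u)=\mu$ for every vertex $v$; $G$ is group vertex magic if it is $\Gamma$-vertex magic for every nontrivial Abelian group $\Gamma$. A pendant vertex has degree $1$. The direct product $G\times H$ has vertex set $V(G)\times V(H)$ with $(g,h)\sim(g',h')$ iff $gg'\in E(G)$ and $hh'\in E(H)$. -}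

module Defs where

open import Level using (0ℓ)
open import Data.Bool using (Bool; true; false; if_then_else_; _∧_)
open import Data.Nat using (ℕ; zero; suc; _*_; _<_)
open import Data.Fin using (Fin; remQuot)
open import Data.List using (List; map; allFin)
open import Data.Nat.ListAction using (sum)
open import Data.Product using (Σ; ∃; _×_; _,_; proj₁; proj₂)
open import Relation.Binary.PropositionalEquality using (_≡_; refl; cong₂)
open import Relation.Nullary using (¬_)
open import Algebra.Bundles using (AbelianGroup)
import Algebra.Definitions.RawMonoid as RM

record Graph : Set where
  field
    n     : ℕ
    adj   : Fin n → Fin n → Bool
    sym   : ∀ u v → adj u v ≡ adj v u
    irrefl : ∀ v → adj v v ≡ false
open Graph public

deg : (G : Graph) → Fin (n G) → ℕ
deg G v = sum (map (λ u → if adj G v u then 1 else 0) (allFin (n G)))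

Pendant : (G : Graph) → Fin (n G) → Set
Pendant G v = deg G v ≡ 1

data Walk (G : Graph) : ℕ → Fin (n G) → Fin (n G) → Set where
  here : ∀ {v} → Walk G zero v v
  step : ∀ {k u w v} → adj G u w ≡ true → Walk G k w v → Walk G (suc k) u v

Dist : (G : Graph) → Fin (n G) → Fin (n G) → ℕ → Set
Dist G u v k = Walk G k u v × (∀ m → m < k → ¬ Walk G m u v)

-- direct (tensor / categorical) product G × H; the vertex (g,h) is encoded
-- as the element of Fin (n G * n H) whose remQuot is (g , h)
-- coordinates of a product vertex
fstV : (G H : Graph) → Fin (n G * n H) → Fin (n G)
fstV G H i = proj₁ (remQuot {n G} (n H) i)

sndV : (G H : Graph) → Fin (n G * n H) → Fin (n H)
sndV G H i = proj₂ (remQuot {n G} (n H) i)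

prodAdj : (G H : Graph) → Fin (n G * n H) → Fin (n G * n H) → Bool
prodAdj G H i j = adj G (fstV G H i) (fstV G H j) ∧ adj H (sndV G H i) (sndV G H j)

prodAdj-sym : (G H : Graph) → ∀ i j → prodAdj G H i j ≡ prodAdj G H j i
prodAdj-sym G H i j = cong₂ _∧_ (sym G (fstV G H i) (fstV G H j)) (sym H (sndV G H i) (sndV G H j))

prodAdj-irrefl : (G H : Graph) → ∀ i → prodAdj G H i i ≡ false
prodAdj-irrefl G H i rewrite irrefl G (fstV G H i) = refl

directProduct : Graph → Graph → Graph
directProduct G H = record
  { n = n G * n H ; adj = prodAdj G H ; sym = prodAdj-sym G H ; irrefl = prodAdj-irrefl G H }

module _ (Γ : AbelianGroup 0ℓ 0ℓ) where
  open AbelianGroup Γ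
  open RM rawMonoid using () renaming (sum to Σᴳ)

  Nontrivial : Set
  Nontrivial = Σ Carrier λ x → ¬ (x ≈ ε)

  weight : (G : Graph) → (Fin (n G) → Carrier) → Fin (n G) → Carrier
  weight G ℓ v = Σᴳ (λ u → if adj G v u then ℓ u else ε)

  IsVertexMagicLabeling : (G : Graph) → (Fin (n G) → Carrier) → Set
  IsVertexMagicLabeling G ℓ =
    (∀ v → ¬ (ℓ v ≈ ε)) × (Σ Carrier λ μ → ∀ v → weight G ℓ v ≈ μ)

  VertexMagic : Graph → Set
  VertexMagic G = Σ (Fin (n G) → Carrier) λ ℓ → IsVertexMagicLabeling G ℓ

GroupVertexMagic : Graph → Set₁
GroupVertexMagic G = (Γ : AbelianGroup 0ℓ 0ℓ) → Nontrivial Γ → VertexMagic Γ G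

{-# OPTIONS --safe #-}
-- Let y be the neighbour of the pendant vertex x of H, w a common neighbour of u and v,
-- and t the other neighbour of v. In G × H the vertex (u,x) has (w,y) as its only
-- neighbour, while (v,x) has exactly the neighbours (w,y) and (t,y). Equal weights at
-- these two vertices force ℓ(w,y) + ℓ(t,y) = ℓ(w,y), so ℓ(t,y) = 0 for every labeling
-- in every Abelian group.
module Submission where

open import Defs
open import Data.Fin using (Fin)
open import Data.Product using (Σ; _×_)
open import Relation.Binary.PropositionalEquality using (_≡_)
open import Relation.Nullary using (¬_)

open import Level using (0ℓ)
open import Algebra.Bundles using (AbelianGroup; CommutativeMonoid)
import Algebra.Properties.AbelianGroup as AbelianGroupProperties
import Algebra.Properties.CommutativeMonoid.Sum as CommutativeMonoidSum
open import Data.Bool using (Bool; true; false; if_then_else_; _∧_)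
open import Data.Empty using (⊥-elim)
open import Data.Fin using (zero; suc; combine; punchIn; punchOut)
open import Data.Fin.Properties
  using (_≟_; remQuot-combine; combine-remQuot; combine-injectiveˡ;
         punchInᵢ≢i; punchIn-punchOut; punchOut-punchIn; punchOut-cong)
open import Data.Integer using (1ℤ)
open import Data.Integer.Properties using (+-0-abelianGroup)
open import Data.List using (tabulate)
open import Data.List.Properties using (map-tabulate)
open import Data.Nat using (ℕ; suc; _+_)
open import Data.Nat.ListAction using (sum)
open import Data.Nat.Properties using (+-suc; suc-injective)
open import Data.Product using (∃; _,_; proj₁; proj₂)
open import Data.Sum using (_⊎_; inj₁; inj₂; [_,_]′) renaming (map to ⊎-map)
open import Function using (_∘_)
open import Relation.Binary.PropositionalEquality using (_≢_; refl; trans; cong; cong₂)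
import Relation.Binary.PropositionalEquality as ≡
open import Relation.Nullary using (yes; no; does)
import Relation.Binary.Reasoning.Setoid

count : ∀ {m} → (Fin m → Bool) → ℕ
count {ℕ.zero} b = 0
count {suc m}  b = (if b zero then 1 else 0) + count (b ∘ suc)

deg≡count : (G : Graph) (v : Fin (n G)) → deg G v ≡ count (adj G v)
deg≡count G v =
  trans (cong sum (map-tabulate {n = n G} (λ z → z) (λ u → if adj G v u then 1 else 0)))
        (sum-tabulate (adj G v))
  where
  sum-tabulate : ∀ {m} (b : Fin m → Bool) → sum (tabulate (λ z → if b z then 1 else 0)) ≡ count b
  sum-tabulate {ℕ.zero} b = refl
  sum-tabulate {suc m}  b = cong ((if b zero then 1 else 0) +_) (sum-tabulate (b ∘ suc))

remove : ∀ {m} → Fin m → (Fin m → Bool) → Fin m → Bool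
remove w b z = if does (z ≟ w) then false else b z

remove-≢ : ∀ {m} (w : Fin m) b {z} → z ≢ w → remove w b z ≡ b z
remove-≢ w b {z} z≢w with z ≟ w
... | yes z≡w = ⊥-elim (z≢w z≡w)
... | no _    = refl

remove-true : ∀ {m} (w : Fin m) b {z} → remove w b z ≡ true → z ≢ w × b z ≡ true
remove-true w b {z} e with z ≟ w
... | no z≢w = z≢w , e

count-remove : ∀ {m} (b : Fin m → Bool) {w} → b w ≡ true → count b ≡ suc (count (remove w b))
count-remove b {zero}  bw rewrite bw = refl
count-remove b {suc w} bw =
  trans (cong ((if b zero then 1 else 0) +_) (count-remove (b ∘ suc) bw))
        (+-suc (if b zero then 1 else 0) _)

count-remove-suc : ∀ {m} (b : Fin m → Bool) {w k} → b w ≡ true → count b ≡ suc k →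
  count (remove w b) ≡ k
count-remove-suc b bw c≡1+k = suc-injective (trans (≡.sym (count-remove b bw)) c≡1+k)

count≡suc⇒∃ : ∀ {m} (b : Fin m → Bool) {k} → count b ≡ suc k → ∃ λ z → b z ≡ true
count≡suc⇒∃ {suc m} b c≡1+k with b zero in b₀
... | true  = zero , b₀
... | false = let z , bz = count≡suc⇒∃ (b ∘ suc) c≡1+k in suc z , bz

count≡0⇒false : ∀ {m} (b : Fin m → Bool) → count b ≡ 0 → ∀ z → b z ≢ true
count≡0⇒false b c≡0 z bz with () ← trans (≡.sym c≡0) (count-remove b bz)

count≡1⇒unique : ∀ {m} (b : Fin m → Bool) {w z} → count b ≡ 1 → b w ≡ true → b z ≡ true → z ≡ w
count≡1⇒unique b {w} {z} c≡1 bw bz with z ≟ w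
... | yes z≡w = z≡w
... | no z≢w  = ⊥-elim (count≡0⇒false (remove w b) (count-remove-suc b bw c≡1) z
                          (trans (remove-≢ w b z≢w) bz))

count≡2⇒other : ∀ {m} (b : Fin m → Bool) {w} → count b ≡ 2 → b w ≡ true → ∃ λ t → t ≢ w × b t ≡ true
count≡2⇒other b {w} c≡2 bw =
  let t , bt = count≡suc⇒∃ (remove w b) (count-remove-suc b bw c≡2) in t , remove-true w b bt

count≡2⇒pair : ∀ {m} (b : Fin m → Bool) {w t z} → count b ≡ 2 → b w ≡ true → b t ≡ true → t ≢ w →
  b z ≡ true → z ≡ w ⊎ z ≡ t
count≡2⇒pair b {w} {t} {z} c≡2 bw bt t≢w bz with z ≟ w
... | yes z≡w = inj₁ z≡w
... | no z≢w  = inj₂ (count≡1⇒unique (remove w b) (count-remove-suc b bw c≡2)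
                       (trans (remove-≢ w b t≢w) bt) (trans (remove-≢ w b z≢w) bz))

module _ (G : Graph) {v : Fin (n G)} where

  deg≡suc⇒neighbour : ∀ {k} → deg G v ≡ suc k → ∃ λ a → adj G v a ≡ true
  deg≡suc⇒neighbour d = count≡suc⇒∃ (adj G v) (trans (≡.sym (deg≡count G v)) d)

  deg≡1⇒unique : deg G v ≡ 1 → ∀ {a} → adj G v a ≡ true → ∀ z → adj G v z ≡ true → z ≡ a
  deg≡1⇒unique d va z vz = count≡1⇒unique (adj G v) (trans (≡.sym (deg≡count G v)) d) va vz

  deg≡2⇒other : deg G v ≡ 2 → ∀ {a} → adj G v a ≡ true → ∃ λ b → b ≢ a × adj G v b ≡ true
  deg≡2⇒other d = count≡2⇒other (adj G v) (trans (≡.sym (deg≡count G v)) d)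

  deg≡2⇒pair : deg G v ≡ 2 → ∀ {a b} → adj G v a ≡ true → adj G v b ≡ true → b ≢ a →
    ∀ z → adj G v z ≡ true → z ≡ a ⊎ z ≡ b
  deg≡2⇒pair d va vb b≢a z = count≡2⇒pair (adj G v) (trans (≡.sym (deg≡count G v)) d) va vb b≢a

module SupportedSum {c ℓ} (M : CommutativeMonoid c ℓ) where
  open CommutativeMonoid M using (Carrier; _≈_; _∙_; ε; ∙-congˡ; identityʳ; setoid)
    renaming (trans to ≈-trans)
  open CommutativeMonoidSum M using (sum-remove; sum-cong-≋; sum-replicate-zero)
    renaming (sum to ∑)

  sum-≈ε : ∀ {m} (f : Fin m → Carrier) → (∀ i → f i ≈ ε) → ∑ f ≈ ε
  sum-≈ε {m} f f≈ε = ≈-trans (sum-cong-≋ f≈ε) (sum-replicate-zero m)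

  sum-supported-at : ∀ {m} (f : Fin m → Carrier) {j} → (∀ i → i ≢ j → f i ≈ ε) → ∑ f ≈ f j
  sum-supported-at {suc m} f {j} f≈ε = begin
    ∑ f                      ≈⟨ sum-remove f ⟩
    f j ∙ ∑ (f ∘ punchIn j)  ≈⟨ ∙-congˡ (sum-≈ε _ (λ i → f≈ε (punchIn j i) (punchInᵢ≢i j i))) ⟩
    f j ∙ ε                  ≈⟨ identityʳ (f j) ⟩
    f j                      ∎
    where open Relation.Binary.Reasoning.Setoid setoid

  sum-supported-at-pair : ∀ {m} (f : Fin m → Carrier) {j k} → j ≢ k →
    (∀ i → i ≢ j → i ≢ k → f i ≈ ε) → ∑ f ≈ f j ∙ f k
  sum-supported-at-pair {suc m} f {j} {k} j≢k f≈ε = begin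
    ∑ f                                 ≈⟨ sum-remove f ⟩
    f j ∙ ∑ (f ∘ punchIn j)             ≈⟨ ∙-congˡ (sum-supported-at (f ∘ punchIn j) off-k) ⟩
    f j ∙ f (punchIn j (punchOut j≢k))  ≡⟨ cong (λ i → f j ∙ f i) (punchIn-punchOut j≢k) ⟩
    f j ∙ f k                           ∎
    where
    open Relation.Binary.Reasoning.Setoid setoid
    off-k : ∀ i → i ≢ punchOut j≢k → f (punchIn j i) ≈ ε
    off-k i i≢ = f≈ε (punchIn j i) (punchInᵢ≢i j i)
      (λ e → i≢ (trans (≡.sym (punchOut-punchIn j)) (punchOut-cong j e)))

∧≡true⁻ : ∀ {x y} → x ∧ y ≡ true → x ≡ true × y ≡ true
∧≡true⁻ {true}  {true}  _  = refl , refl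
∧≡true⁻ {true}  {false} ()
∧≡true⁻ {false}         ()

module _ (G H : Graph) where

  fstV-combine : ∀ g h → fstV G H (combine g h) ≡ g
  fstV-combine g h = cong proj₁ (remQuot-combine {n G} g h)

  sndV-combine : ∀ g h → sndV G H (combine g h) ≡ h
  sndV-combine g h = cong proj₂ (remQuot-combine {n G} g h)

  ×-adj⁺ : ∀ {g g' h h'} → adj G g g' ≡ true → adj H h h' ≡ true →
    adj (directProduct G H) (combine g h) (combine g' h') ≡ true
  ×-adj⁺ {g} {g'} {h} {h'} gg' hh' = trans
    (cong₂ _∧_ (cong₂ (adj G) (fstV-combine g h) (fstV-combine g' h'))
               (cong₂ (adj H) (sndV-combine g h) (sndV-combine g' h')))
    (cong₂ _∧_ gg' hh')

  ×-adj⁻ : ∀ {g h} z → adj (directProduct G H) (combine g h) z ≡ true →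
    adj G g (fstV G H z) ≡ true × adj H h (sndV G H z) ≡ true
  ×-adj⁻ {g} {h} z e =
    let gz , hz = ∧≡true⁻ e
    in  trans (cong (λ g₀ → adj G g₀ (fstV G H z)) (≡.sym (fstV-combine g h))) gz
      , trans (cong (λ h₀ → adj H h₀ (sndV G H z)) (≡.sym (sndV-combine g h))) hz

  ×-neighbour-unique-snd : ∀ {g h c} → (∀ z → adj H h z ≡ true → z ≡ c) →
    ∀ z → adj (directProduct G H) (combine g h) z ≡ true →
    ∃ λ g' → adj G g g' ≡ true × z ≡ combine g' c
  ×-neighbour-unique-snd only-c z e =
    let gz , hz = ×-adj⁻ z e
    in  fstV G H z , gz
      , trans (≡.sym (combine-remQuot {n G} (n H) z)) (cong (combine (fstV G H z)) (only-c _ hz))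

module _ (Γ : AbelianGroup 0ℓ 0ℓ) where
  open AbelianGroup Γ using (Carrier; _≈_; _∙_; ε; setoid; commutativeMonoid) renaming (refl to ≈-refl)
  open AbelianGroupProperties Γ using (identityʳ-unique)
  open SupportedSum commutativeMonoid
  open Relation.Binary.Reasoning.Setoid setoid

  if-≢true : ∀ {b} (x : Carrier) → b ≢ true → (if b then x else ε) ≈ ε
  if-≢true {true}  x b≢true = ⊥-elim (b≢true refl)
  if-≢true {false} x _      = ≈-refl

  if-true : ∀ {b} (x : Carrier) → b ≡ true → (if b then x else ε) ≡ x
  if-true x refl = refl

  weight-single : (G : Graph) (ℓ : Fin (n G) → Carrier) → ∀ {v a} → adj G v a ≡ true →
    (∀ z → adj G v z ≡ true → z ≡ a) → weight Γ G ℓ v ≈ ℓ a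
  weight-single G ℓ {v} {a} va only-a = begin
    weight Γ G ℓ v                  ≈⟨ sum-supported-at _ off-a ⟩
    (if adj G v a then ℓ a else ε)  ≡⟨ if-true (ℓ a) va ⟩
    ℓ a                             ∎
    where
    off-a : ∀ z → z ≢ a → (if adj G v z then ℓ z else ε) ≈ ε
    off-a z z≢a = if-≢true (ℓ z) (z≢a ∘ only-a z)

  weight-pair : (G : Graph) (ℓ : Fin (n G) → Carrier) → ∀ {v a b} → a ≢ b →
    adj G v a ≡ true → adj G v b ≡ true → (∀ z → adj G v z ≡ true → z ≡ a ⊎ z ≡ b) →
    weight Γ G ℓ v ≈ ℓ a ∙ ℓ b
  weight-pair G ℓ {v} {a} {b} a≢b va vb only-ab = begin
    weight Γ G ℓ v  ≈⟨ sum-supported-at-pair _ a≢b off-ab ⟩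
    (if adj G v a then ℓ a else ε) ∙ (if adj G v b then ℓ b else ε)
                    ≡⟨ cong₂ _∙_ (if-true (ℓ a) va) (if-true (ℓ b) vb) ⟩
    ℓ a ∙ ℓ b       ∎
    where
    off-ab : ∀ z → z ≢ a → z ≢ b → (if adj G v z then ℓ z else ε) ≈ ε
    off-ab z z≢a z≢b = if-≢true (ℓ z) λ vz → [ z≢a , z≢b ]′ (only-ab z vz)

  ¬VertexMagic-nested-neighbourhoods : (G : Graph) → ∀ {p q a b} → a ≢ b →
    adj G p a ≡ true → (∀ z → adj G p z ≡ true → z ≡ a) →
    adj G q a ≡ true → adj G q b ≡ true → (∀ z → adj G q z ≡ true → z ≡ a ⊎ z ≡ b) →
    ¬ VertexMagic Γ G
  ¬VertexMagic-nested-neighbourhoods G {p} {q} {a} {b} a≢b pa only-a qa qb only-ab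
    (ℓ , ℓ≉ε , μ , magic) =
    ℓ≉ε b (identityʳ-unique (ℓ a) (ℓ b) (begin
      ℓ a ∙ ℓ b       ≈⟨ weight-pair G ℓ a≢b qa qb only-ab ⟨
      weight Γ G ℓ q  ≈⟨ magic q ⟩
      μ               ≈⟨ magic p ⟨
      weight Γ G ℓ p  ≈⟨ weight-single G ℓ pa only-a ⟩
      ℓ a             ∎))

  product-not-vertexMagic : (G H : Graph) → ∀ {u v w x} → deg G u ≡ 1 → deg G v ≡ 2 →
    adj G u w ≡ true → adj G v w ≡ true → Pendant H x → ¬ VertexMagic Γ (directProduct G H)
  product-not-vertexMagic G H {u} {v} {w} {x} deg-u deg-v uw vw deg-x
    with deg≡suc⇒neighbour H deg-x | deg≡2⇒other G deg-v vw
  ... | y , xy | t , t≢w , vt =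
    ¬VertexMagic-nested-neighbourhoods (directProduct G H) wy≢ty
      (×-adj⁺ G H uw xy) only-wy (×-adj⁺ G H vw xy) (×-adj⁺ G H vt xy) only-wy-ty
    where
    only-y : ∀ z → adj H x z ≡ true → z ≡ y
    only-y = deg≡1⇒unique H deg-x xy
    wy≢ty : combine w y ≢ combine t y
    wy≢ty e = t≢w (≡.sym (combine-injectiveˡ w y t y e))
    only-wy : ∀ z → adj (directProduct G H) (combine u x) z ≡ true → z ≡ combine w y
    only-wy z e with ×-neighbour-unique-snd G H only-y z e
    ... | g , ug , refl = cong (λ g₀ → combine g₀ y) (deg≡1⇒unique G deg-u uw g ug)
    only-wy-ty : ∀ z → adj (directProduct G H) (combine v x) z ≡ true →
      z ≡ combine w y ⊎ z ≡ combine t y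
    only-wy-ty z e with ×-neighbour-unique-snd G H only-y z e
    ... | g , vg , refl = ⊎-map (cong (λ g₀ → combine g₀ y)) (cong (λ g₀ → combine g₀ y))
                            (deg≡2⇒pair G deg-v vw vt t≢w g vg)

theorem3p13 : (G H : Graph) (u v : Fin (n G)) → deg G u ≡ 1 → deg G v ≡ 2 → Dist G u v 2
    → Σ (Fin (n H)) (λ x → Pendant H x) → ¬ GroupVertexMagic (directProduct G H)
theorem3p13 G H u v deg-u deg-v (step uw (step wv here) , _) (x , deg-x) group-magic =
  product-not-vertexMagic ℤ G H deg-u deg-v uw (trans (Graph.sym G v _) wv) deg-x
    (group-magic ℤ (1ℤ , λ ()))
  where
  ℤ : AbelianGroup 0ℓ 0ℓ
  ℤ = +-0-abelianGroup
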